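{- Let $K$ be a commutative $\mathbb{Q}$-algebra and $a,b\in K$. Let $H$ be the matroid Hopf algebra over $\mathbb{Q}$, let $\delta_{\mathrm{loop}},\delta_{\mathrm{coloop}}:H\to K$ be the linear maps defined below, and let $\exp_\ast$ be the convolution exponential. Then for every matroid $M=(E,\mathcal{I})$, $$\exp_\ast\{a\,\delta_{\mathrm{coloop}}+b\,\delta_{\mathrm{loop}}\}(M)=a^{r(M)}\,b^{n(M)},$$ where $r(M)=r(E)$ is the rank of $M$, $n(M)=|E|-r(M)$ is its nullity, and $0^0=1$.
   Context: For a matroid $M=(E,\mathcal{I})$ on a finite ground set $E$, $r(A)=\max\{|B|: B\in\mathcal{I}, B\subseteq A\}$ for $A\subseteq E$. For $A\subseteq E$, $M|A$ is the restriction of $M$ to $A$ (the deletion of $E-A$), and $M/A$ is the contraction of $A$, i.e. $M/A=(M^\star\setminus A)^\star$ where $M^\star$ is the dual matroid (whose bases are the complements of bases of $M$). $U_{r,n}$ denotes the uniform matroid of rank $r$ on $n$ elements; $U_{0,1}$ is a single loop and $U_{1,1}$ a single coloop. The matroid Hopf algebra $H$ is the $\mathbb{Q}$-vector space with basis the isomorphism classes of finite matroids, with product given by direct sum $\oplus$, unit the empty matroid $\mathbf{1}$, coproduct $\Delta(M)=\sum_{A\subseteq E} M|A\otimes M/A$, and counit $\epsilon(M)=1$ if $E=\emptyset$ and $0$ otherwise. For linear maps $f,g:H\to K$ the convolution is $f\ast g=m_K\circ(f\otimes g)\circ\Delta$, i.e. $(f\ast g)(M)=\sum_{A\subseteq E}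 f(M|A)g(M/A)$. A linear map $\delta:H\to K$ is an infinitesimal character if $\delta(M_1\oplus M_2)=\delta(M_1)\epsilon(M_2)+\epsilon(M_1)\delta(M_2)$; for such $\delta$, $\exp_\ast(\delta)=\epsilon+\delta+\frac12\delta\ast\delta+\dots=\sum_{k\ge0}\delta^{\ast k}/k!$ (a finite sum when evaluated on any matroid). Define $\delta_{\mathrm{loop}}(M)=1$ if $M\cong U_{0,1}$ and $0$ otherwise, and $\delta_{\mathrm{coloop}}(M)=1$ if $M\cong U_{1,1}$ and $0$ otherwise; these are infinitesimal characters. -}

module Defs where

open import Level using (_⊔_)
open import Data.Bool using (Bool; true; false; _∧_; _∨_; not; if_then_else_; T)
open import Data.Nat using (ℕ; zero; suc; _≡ᵇ_; _<_; _!)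
import Data.Nat as ℕ
open import Data.Nat.Properties using (_!≢0)
open import Data.Vec using (Vec; []; _∷_)
open import Data.List using (List; []; _∷_; map; _++_; foldr; filterᵇ; upTo)
open import Data.Bool.ListAction using (any; all)
open import Data.Fin.Subset using (Subset; ∣_∣; _∩_; _∪_; ∁; ⁅_⁆; ⊥; _∈_; _∉_)
open import Data.Fin using (Fin)
open import Data.Product using (∃; _×_)
open import Data.Integer using (+_)
open import Data.Rational as ℚ using (ℚ)
open import Algebra.Bundles using (CommutativeRing)
open import Algebra.Morphism.Structures using (IsRingHomomorphism)

allSubsets : (n : ℕ) → List (Subset n)
allSubsets zero = [] ∷ []
allSubsets (suc n) = map (false ∷_) (allSubsets n) ++ map (true ∷_) (allSubsets n)

_⊆ᵇ_ : ∀ {n} → Subset n → Subset n → Bool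
[] ⊆ᵇ [] = true
(x ∷ xs) ⊆ᵇ (y ∷ ys) = (not x ∨ y) ∧ (xs ⊆ᵇ ys)

-- Minors of a matroid on Fin n are again set
-- systems on Fin n (with a smaller ground set), so no re-indexing is needed.

record SetSystem (n : ℕ) : Set where
  constructor setSystem
  field
    ground : Subset n
    indep  : Subset n → Bool

open SetSystem public

indepIn : ∀ {n} → SetSystem n → Subset n → Bool
indepIn M X = (X ⊆ᵇ ground M) ∧ indep M X

record IsMatroid {n : ℕ} (M : SetSystem n) : Set where
  field
    indep-ground : ∀ X → T (indep M X) → T (X ⊆ᵇ ground M)
    indep-empty  : T (indep M ⊥)
    indep-hered  : ∀ X Y → T (X ⊆ᵇ Y) → T (indep M Y) → T (indep M X)
    indep-augment : ∀ X Y → T (indep M X) → T (indep M Y) → ∣ X ∣ < ∣ Y ∣ →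
                    ∃ λ y → (y ∈ Y) × (y ∉ X) × T (indep M (X ∪ ⁅ y ⁆))

rank : ∀ {n} → SetSystem n → Subset n → ℕ
rank {n} M A = foldr ℕ._⊔_ 0
  (map ∣_∣ (filterᵇ (λ B → (B ⊆ᵇ A) ∧ indepIn M B) (allSubsets n)))

rk : ∀ {n} → SetSystem n → ℕ
rk M = rank M (ground M)

nullity : ∀ {n} → SetSystem n → ℕ
nullity M = ∣ ground M ∣ ℕ.∸ rk M

isBasis : ∀ {n} → SetSystem n → Subset n → Bool
isBasis {n} M B = indepIn M B ∧
  all (λ Y → not ((B ⊆ᵇ Y) ∧ indepIn M Y) ∨ (Y ⊆ᵇ B)) (allSubsets n)

dual : ∀ {n} → SetSystem n → SetSystem n
dual {n} M = setSystem (ground M)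
  (λ X → any (λ B → isBasis M B ∧ (X ⊆ᵇ (ground M ∩ ∁ B))) (allSubsets n))

restrict : ∀ {n} → SetSystem n → Subset n → SetSystem n
restrict M A = setSystem (ground M ∩ A) (λ X → indep M X ∧ (X ⊆ᵇ A))

delete : ∀ {n} → SetSystem n → Subset n → SetSystem n
delete M A = restrict M (ground M ∩ ∁ A)

contract : ∀ {n} → SetSystem n → Subset n → SetSystem n
contract M A = dual (delete (dual M) A)

record QAlgebra (c ℓ : Level.Level) : Set (Level.suc (c ⊔ ℓ)) where
  field
    cring : CommutativeRing c ℓ
  open CommutativeRing cring public
  field
    ι     : ℚ → Carrier
    ι-hom : IsRingHomomorphism ℚ.+-*-rawRing rawRing ι

module _ {c ℓ} (K : QAlgebra c ℓ) where
  open QAlgebra K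

  -- x ^ k, with x ^ 0 = 1 (so 0 ^ 0 = 1)
  pow : Carrier → ℕ → Carrier
  pow x zero = 1#
  pow x (suc k) = x * pow x k

  sumK : List Carrier → Carrier
  sumK = foldr _+_ 0#

  MapK : Set c
  MapK = ∀ {n} → SetSystem n → Carrier

  εK : MapK
  εK M = if ∣ ground M ∣ ≡ᵇ 0 then 1# else 0#

  conv : MapK → MapK → MapK
  conv f g {n} M = sumK (map (λ A → f (restrict M A) * g (contract M A))
                             (filterᵇ (λ A → A ⊆ᵇ ground M) (allSubsets n)))

  convPow : MapK → ℕ → MapK
  convPow f zero = εK
  convPow f (suc k) = conv f (convPow f k)

  -- δ_loop(M) = 1 iff M ≅ U_{0,1}: one element, whose only independent set is ∅
  δloop : MapK
  δloop M = if (∣ ground M ∣ ≡ᵇ 1) ∧ indepIn M ⊥ ∧ not (indepIn M (ground M))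
            then 1# else 0#

  -- δ_coloop(M) = 1 iff M ≅ U_{1,1}: one element, independent sets ∅ and E
  δcoloop : MapK
  δcoloop M = if (∣ ground M ∣ ≡ᵇ 1) ∧ indepIn M ⊥ ∧ indepIn M (ground M)
              then 1# else 0#

  linComb : Carrier → Carrier → MapK
  linComb a b M = a * δcoloop M + b * δloop M

  -- partial sum Σ_{k=0}^{N} δ^{∗k}(M) / k!  of the convolution exponential
  expPartial : MapK → ℕ → MapK
  expPartial δ N M =
    sumK (map (λ k → ι (ℚ._/_ (+ 1) (k !) {{k !≢0}}) * convPow δ k M) (upTo (suc N)))

module Submission where

-- Write δ = a δ_coloop + b δ_loop.  The heart of the proof is the formula
--   δ^{∗k}(M) = k! a^{r(M)} b^{n(M)}  if k = |E|,  and 0 otherwise,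
-- proved by induction on k.  In δ^{∗(k+1)}(M) = Σ_{A ⊆ E} δ(M|A) δ^{∗k}(M/A)
-- only singletons A = {e} survive; δ(M|e) is a if e is not a loop and b if
-- it is, and the single-element contraction M/e is a matroid on E − e of
-- rank r(M) − 1 resp. r(M), so each of the |E| terms equals k! a^{r(M)} b^{n(M)}.
-- Dividing by k! and summing over k ≤ N leaves only k = |E|.

open import Defs
open import Level using (Level)
open import Data.Nat using (ℕ; _≤_)
open import Data.Fin.Subset using (∣_∣)

open import Data.Bool using (Bool; true; false; T; not; _∧_; _∨_; if_then_else_)
open import Data.Bool.Properties using (T-∧; ∧-zeroʳ; ∧-identityʳ)
open import Data.Bool.ListAction using (all; any)
open import Data.Empty using (⊥-elim)
open import Data.Unit using (tt)
open import Data.Nat using (zero; suc; _+_; _∸_; _<_; _⊔_; _≡ᵇ_; z≤n; s≤s; NonZero)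
import Data.Nat.Properties as ℕ
open import Data.Fin using (Fin; zero; suc; _≟_)
open import Data.Fin.Subset using (Subset; _⊆_; _∈_; _∉_; _∩_; _∪_; ∁; ⁅_⁆)
import Data.Fin.Subset as Subset
open import Data.Fin.Subset.Properties
  using (drop-∷-⊆; ⊆-refl; p⊆q⇒∣p∣≤∣q∣; ⊆-antisym; Empty-unique; ∣⊥∣≡0; ∣⁅x⁆∣≡1;
         x∈⁅x⁆; x∈⁅y⁆⇒x≡y; x∈p∩q⁺; x∈p∪q⁻; p∩q⊆p; p∩q⊆q; p⊆p∪q; q⊆p∪q;
         x∉p⇒x∈∁p; x∈∁p⇒x∉p; ⊥⊆; _∈?_)
open import Data.Vec using ([]; _∷_; here; there)
import Data.Integer as ℤ
open import Data.Rational using (ℚ)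
import Data.Rational as ℚ
import Data.Rational.Properties as ℚ
open import Data.Rational.Unnormalised using (mkℚᵘ; *≡*)
import Data.Rational.Unnormalised as ℚᵘ
import Data.Rational.Unnormalised.Properties as ℚᵘ
open import Data.List using (List; []; _∷_; map; _++_; foldr; filterᵇ; upTo; applyUpTo)
open import Data.List.Properties using (map-upTo)
import Data.List.Membership.Propositional as List
open import Data.List.Membership.Propositional.Properties
  using (∈-map⁺; ∈-map⁻; ∈-++⁺ˡ; ∈-++⁺ʳ; ∈-filter⁺; ∈-filter⁻)
open import Data.List.Relation.Unary.Any using (here; there)
open import Data.List.Relation.Unary.Any.Properties using (any⁺; any⁻)
import Data.List.Relation.Unary.Any as Any
open import Data.List.Relation.Unary.All using (lookup; tabulate)
open import Data.List.Relation.Unary.All.Properties using (all⁺; all⁻)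
open import Data.Product using (∃; _×_; _,_; proj₁; proj₂; uncurry)
open import Data.Sum using (_⊎_; inj₁; inj₂; [_,_]′)
open import Function using (_∘_; Equivalence)
open import Algebra.Morphism.Structures using (IsRingHomomorphism)
open import Relation.Nullary using (¬_; yes; no)
open import Relation.Nullary.Decidable using (T?)
open import Relation.Binary.PropositionalEquality
  using (_≡_; _≢_; refl; sym; trans; cong; cong₂; subst; subst₂; module ≡-Reasoning)

∧-intro : ∀ {x y} → T x → T y → T (x ∧ y)
∧-intro p q = Equivalence.from T-∧ (p , q)

∧-fst : ∀ {x y} → T (x ∧ y) → T x
∧-fst = proj₁ ∘ Equivalence.to T-∧

∧-snd : ∀ {x y} → T (x ∧ y) → T y
∧-snd {x} = proj₂ ∘ Equivalence.to (T-∧ {x})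

⇒ᵇ-intro : ∀ x {y} → (T x → T y) → T (not x ∨ y)
⇒ᵇ-intro true f = f tt
⇒ᵇ-intro false f = tt

⇒ᵇ-elim : ∀ x {y} → T (not x ∨ y) → T x → T y
⇒ᵇ-elim true t _ = t

T⇒≡true : ∀ {x} → T x → x ≡ true
T⇒≡true {true} _ = refl

¬T⇒≡false : ∀ {x} → ¬ T x → x ≡ false
¬T⇒≡false {false} _ = refl
¬T⇒≡false {true} ¬t = ⊥-elim (¬t tt)

⊆ᵇ⇒⊆ : ∀ {n} {X Y : Subset n} → T (X ⊆ᵇ Y) → X ⊆ Y
⊆ᵇ⇒⊆ {X = false ∷ X} {y ∷ Y} h (there p) = there (⊆ᵇ⇒⊆ h p)
⊆ᵇ⇒⊆ {X = true ∷ X} {true ∷ Y} h here = here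
⊆ᵇ⇒⊆ {X = true ∷ X} {true ∷ Y} h (there p) = there (⊆ᵇ⇒⊆ h p)

⊆⇒⊆ᵇ : ∀ {n} {X Y : Subset n} → X ⊆ Y → T (X ⊆ᵇ Y)
⊆⇒⊆ᵇ {X = []} {[]} h = tt
⊆⇒⊆ᵇ {X = false ∷ X} {y ∷ Y} h = ⊆⇒⊆ᵇ (drop-∷-⊆ h)
⊆⇒⊆ᵇ {X = true ∷ X} {false ∷ Y} h with h here
... | ()
⊆⇒⊆ᵇ {X = true ∷ X} {true ∷ Y} h = ⊆⇒⊆ᵇ (drop-∷-⊆ h)

-- allSubsets n enumerates every subset, so Boolean quantifiers over it
-- are genuine quantifiers over Subset n.
∈-allSubsets : ∀ {n} (X : Subset n) → X List.∈ allSubsets n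
∈-allSubsets [] = here refl
∈-allSubsets (false ∷ X) = ∈-++⁺ˡ (∈-map⁺ (false ∷_) (∈-allSubsets X))
∈-allSubsets {suc n} (true ∷ X) =
  ∈-++⁺ʳ (map (false ∷_) (allSubsets n)) (∈-map⁺ (true ∷_) (∈-allSubsets X))

all-subsets-intro : ∀ {n} (p : Subset n → Bool) → (∀ X → T (p X)) → T (all p (allSubsets n))
all-subsets-intro {n} p h = all⁻ p {xs = allSubsets n} (tabulate λ {X} _ → h X)

all-subsets-elim : ∀ {n} (p : Subset n → Bool) → T (all p (allSubsets n)) → ∀ X → T (p X)
all-subsets-elim p h X = lookup (all⁺ p _ h) (∈-allSubsets X)

any-subsets-intro : ∀ {n} (p : Subset n → Bool) X → T (p X) → T (any p (allSubsets n))
any-subsets-intro p X t = any⁺ p (Any.map (λ { refl → t }) (∈-allSubsets X))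

any-subsets-elim : ∀ {n} (p : Subset n → Bool) → T (any p (allSubsets n)) → ∃ λ X → T (p X)
any-subsets-elim {n} p t = Any.satisfied (any⁻ p (allSubsets n) t)

∪-⊆ : ∀ {n} {X Z A : Subset n} → X ⊆ A → Z ⊆ A → X ∪ Z ⊆ A
∪-⊆ {X = X} {Z} X⊆A Z⊆A p = [ X⊆A , Z⊆A ]′ (x∈p∪q⁻ X Z p)

⊆-∩ : ∀ {n} {X A B : Subset n} → X ⊆ A → X ⊆ B → X ⊆ A ∩ B
⊆-∩ X⊆A X⊆B p = x∈p∩q⁺ (X⊆A p , X⊆B p)

⁅⁆-⊆ : ∀ {n} {y : Fin n} {A} → y ∈ A → ⁅ y ⁆ ⊆ A
⁅⁆-⊆ {y = y} {A} y∈A q = subst (_∈ A) (sym (x∈⁅y⁆⇒x≡y y q)) y∈A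

Disjoint : ∀ {n} → Subset n → Subset n → Set
Disjoint X Z = ∀ {x} → x ∈ X → x ∉ Z

∣∪∣-disjoint : ∀ {n} (X Z : Subset n) → Disjoint X Z → ∣ X ∪ Z ∣ ≡ ∣ X ∣ + ∣ Z ∣
∣∪∣-disjoint [] [] d = refl
∣∪∣-disjoint (false ∷ X) (false ∷ Z) d = ∣∪∣-disjoint X Z (λ p q → d (there p) (there q))
∣∪∣-disjoint (false ∷ X) (true ∷ Z) d =
  trans (cong suc (∣∪∣-disjoint X Z (λ p q → d (there p) (there q)))) (sym (ℕ.+-suc _ _))
∣∪∣-disjoint (true ∷ X) (false ∷ Z) d = cong suc (∣∪∣-disjoint X Z (λ p q → d (there p) (there q)))
∣∪∣-disjoint (true ∷ X) (true ∷ Z) d = ⊥-elim (d here here)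

∣∪⁅⁆∣ : ∀ {n} {X : Subset n} {y} → y ∉ X → ∣ X ∪ ⁅ y ⁆ ∣ ≡ suc ∣ X ∣
∣∪⁅⁆∣ {X = X} {y} y∉X = begin
  ∣ X ∪ ⁅ y ⁆ ∣   ≡⟨ ∣∪∣-disjoint X ⁅ y ⁆ (λ p q → y∉X (subst (_∈ X) (x∈⁅y⁆⇒x≡y y q) p)) ⟩
  ∣ X ∣ + ∣ ⁅ y ⁆ ∣ ≡⟨ cong (∣ X ∣ +_) (∣⁅x⁆∣≡1 y) ⟩
  ∣ X ∣ + 1       ≡⟨ ℕ.+-comm ∣ X ∣ 1 ⟩
  suc ∣ X ∣       ∎
  where open ≡-Reasoning

⊆-∣∣-reverse : ∀ {n} {X Y : Subset n} → X ⊆ Y → ∣ Y ∣ ≤ ∣ X ∣ → Y ⊆ X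
⊆-∣∣-reverse {X = false ∷ X} {false ∷ Y} s c (there p) = there (⊆-∣∣-reverse (drop-∷-⊆ s) c p)
⊆-∣∣-reverse {X = true ∷ X} {false ∷ Y} s c (there p) with s here
... | ()
⊆-∣∣-reverse {X = true ∷ X} {true ∷ Y} s c here = here
⊆-∣∣-reverse {X = true ∷ X} {true ∷ Y} s (s≤s c) (there p) = there (⊆-∣∣-reverse (drop-∷-⊆ s) c p)
⊆-∣∣-reverse {X = false ∷ X} {true ∷ Y} s c p =
  ⊥-elim (ℕ.<-irrefl refl (ℕ.≤-trans c (p⊆q⇒∣p∣≤∣q∣ (drop-∷-⊆ s))))

∣∣≡1⇒singleton : ∀ {n} (A : Subset n) → ∣ A ∣ ≡ 1 → ∃ λ e → A ≡ ⁅ e ⁆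
∣∣≡1⇒singleton (false ∷ A) c with ∣∣≡1⇒singleton A c
... | e , refl = suc e , refl
∣∣≡1⇒singleton (true ∷ A) c =
  zero , cong (true ∷_) (Empty-unique (λ (x , p) → empty A (ℕ.suc-injective c) p))
  where
  empty : ∀ {n} (A : Subset n) → ∣ A ∣ ≡ 0 → ∀ {x} → x ∉ A
  empty (true ∷ A) () here
  empty (true ∷ A) () (there p)
  empty (false ∷ A) c (there p) = empty A c p

max-ub : ∀ {x xs} → x List.∈ xs → x ≤ foldr _⊔_ 0 xs
max-ub (here refl) = ℕ.m≤m⊔n _ _
max-ub {xs = y ∷ xs} (there p) = ℕ.≤-trans (max-ub p) (ℕ.m≤n⊔m y _)

max-lub : ∀ {b} xs → (∀ {x} → x List.∈ xs → x ≤ b) → foldr _⊔_ 0 xs ≤ b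
max-lub [] h = z≤n
max-lub (x ∷ xs) h = ℕ.⊔-lub (h (here refl)) (max-lub xs (h ∘ there))

max-attained : ∀ xs → foldr _⊔_ 0 xs ≡ 0 ⊎ foldr _⊔_ 0 xs List.∈ xs
max-attained [] = inj₁ refl
max-attained (x ∷ xs) with ℕ.⊔-sel x (foldr _⊔_ 0 xs) | max-attained xs
... | inj₁ e | _ = inj₂ (here e)
... | inj₂ e | inj₁ z = inj₁ (trans e z)
... | inj₂ e | inj₂ p = inj₂ (subst (List._∈ x ∷ xs) (sym e) (there p))

module SetSystemFacts {n} (M : SetSystem n) where

  private
    maximalTest : Subset n → Subset n → Bool
    maximalTest B Y = not ((B ⊆ᵇ Y) ∧ indepIn M Y) ∨ (Y ⊆ᵇ B)

  isBasis-intro : ∀ {B} → T (indepIn M B) → (∀ {Y} → B ⊆ Y → T (indepIn M Y) → Y ⊆ B) →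
                  T (isBasis M B)
  isBasis-intro {B} iB max = ∧-intro iB (all-subsets-intro (maximalTest B) λ Y →
    ⇒ᵇ-intro ((B ⊆ᵇ Y) ∧ indepIn M Y) λ t → ⊆⇒⊆ᵇ (max (⊆ᵇ⇒⊆ (∧-fst t)) (∧-snd {B ⊆ᵇ Y} t)))

  isBasis-indep : ∀ {B} → T (isBasis M B) → T (indepIn M B)
  isBasis-indep = ∧-fst

  isBasis-maximal : ∀ {B Y} → T (isBasis M B) → B ⊆ Y → T (indepIn M Y) → Y ⊆ B
  isBasis-maximal {B} {Y} b B⊆Y iY =
    ⊆ᵇ⇒⊆ (⇒ᵇ-elim ((B ⊆ᵇ Y) ∧ indepIn M Y)
            (all-subsets-elim (maximalTest B) (∧-snd {indepIn M B} b) Y)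
            (∧-intro (⊆⇒⊆ᵇ B⊆Y) iY))

  private
    candidate : Subset n → Subset n → Bool
    candidate A B = (B ⊆ᵇ A) ∧ indepIn M B

  rank-ub : ∀ {A B} → B ⊆ A → T (indepIn M B) → ∣ B ∣ ≤ rank M A
  rank-ub {A} {B} s i =
    max-ub (∈-map⁺ ∣_∣ (∈-filter⁺ (T? ∘ candidate A) (∈-allSubsets B) (∧-intro (⊆⇒⊆ᵇ s) i)))

  rank-lub : ∀ {A b} → (∀ B → B ⊆ A → T (indepIn M B) → ∣ B ∣ ≤ b) → rank M A ≤ b
  rank-lub {A} h = max-lub _ λ p →
    let (B , q , e) = ∈-map⁻ ∣_∣ p
        (_ , t) = ∈-filter⁻ (T? ∘ candidate A) {xs = allSubsets n} q
    in subst (_≤ _) (sym e) (h B (⊆ᵇ⇒⊆ (∧-fst {B ⊆ᵇ A} t)) (∧-snd {B ⊆ᵇ A} t))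

  rank-attained : ∀ A → T (indepIn M Subset.⊥) →
                  ∃ λ B → B ⊆ A × T (indepIn M B) × ∣ B ∣ ≡ rank M A
  rank-attained A i∅ with max-attained (map ∣_∣ (filterᵇ (candidate A) (allSubsets n)))
  ... | inj₁ z = Subset.⊥ , ⊥⊆ , i∅ , trans (∣⊥∣≡0 n) (sym z)
  ... | inj₂ p =
    let (B , q , e) = ∈-map⁻ ∣_∣ p
        (_ , t) = ∈-filter⁻ (T? ∘ candidate A) {xs = allSubsets n} q
    in B , ⊆ᵇ⇒⊆ (∧-fst {B ⊆ᵇ A} t) , ∧-snd {B ⊆ᵇ A} t , sym e

  rk≤∣ground∣ : rk M ≤ ∣ ground M ∣
  rk≤∣ground∣ = rank-lub λ B B⊆E _ → p⊆q⇒∣p∣≤∣q∣ B⊆E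

module MatroidFacts {n} (M : SetSystem n) (isMatroid : IsMatroid M) where
  open IsMatroid isMatroid
  open SetSystemFacts M public

  E : Subset n
  E = ground M

  Indep : Subset n → Set
  Indep X = T (indep M X)

  r : ℕ
  r = rk M

  indep⊆E : ∀ {X} → Indep X → X ⊆ E
  indep⊆E {X} i = ⊆ᵇ⇒⊆ (indep-ground X i)

  indep⇒indepIn : ∀ {X} → Indep X → T (indepIn M X)
  indep⇒indepIn {X} i = ∧-intro (indep-ground X i) i

  indepIn⇒indep : ∀ {X} → T (indepIn M X) → Indep X
  indepIn⇒indep {X} = ∧-snd {X ⊆ᵇ E}

  hereditary : ∀ {X Y} → Indep Y → X ⊆ Y → Indep X
  hereditary {X} {Y} i s = indep-hered X Y (⊆⇒⊆ᵇ s) i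

  indep-≤-rank : ∀ {A B} → B ⊆ A → Indep B → ∣ B ∣ ≤ rank M A
  indep-≤-rank s i = rank-ub s (indep⇒indepIn i)

  indep-≤-r : ∀ {B} → Indep B → ∣ B ∣ ≤ r
  indep-≤-r i = indep-≤-rank (indep⊆E i) i

  -- Every independent subset X of A extends, inside A, to an independent
  -- set of size r(A): augment X from a maximum independent subset of A.
  extend : ∀ {X A} → Indep X → X ⊆ A →
           ∃ λ Y → X ⊆ Y × Y ⊆ A × Indep Y × ∣ Y ∣ ≡ rank M A
  extend {X₀} {A} i₀ s₀ with rank-attained A (indep⇒indepIn indep-empty)
  ... | B , B⊆A , iB , ∣B∣≡rA = grow ∣ B ∣ X₀ (ℕ.m≤m+n ∣ B ∣ ∣ X₀ ∣) i₀ s₀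
    where
    -- the fuel d bounds the number of remaining augmentation steps
    grow : ∀ d X → ∣ B ∣ ≤ d + ∣ X ∣ → Indep X → X ⊆ A →
           ∃ λ Y → X ⊆ Y × Y ⊆ A × Indep Y × ∣ Y ∣ ≡ rank M A
    grow d X c i s with ∣ X ∣ ℕ.<? ∣ B ∣
    ... | no ∣X∣≮∣B∣ =
      X , ⊆-refl , s , i ,
      ℕ.≤-antisym (indep-≤-rank s i) (subst (_≤ ∣ X ∣) ∣B∣≡rA (ℕ.≮⇒≥ ∣X∣≮∣B∣))
    grow zero X c i s | yes ∣X∣<∣B∣ = ⊥-elim (ℕ.<-irrefl refl (ℕ.<-≤-trans ∣X∣<∣B∣ c))
    grow (suc d) X c i s | yes ∣X∣<∣B∣
      with indep-augment X B i (indepIn⇒indep iB) ∣X∣<∣B∣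
    ... | y , y∈B , y∉X , iXy
      with grow d (X ∪ ⁅ y ⁆) (subst (∣ B ∣ ≤_) (trans (sym (ℕ.+-suc d ∣ X ∣))
                                  (cong (d +_) (sym (∣∪⁅⁆∣ y∉X)))) c)
                iXy (∪-⊆ s (⁅⁆-⊆ (B⊆A y∈B)))
    ... | Y , Xy⊆Y , Y⊆A , iY , ∣Y∣ = Y , Xy⊆Y ∘ p⊆p∪q ⁅ y ⁆ , Y⊆A , iY , ∣Y∣

  Basis : Subset n → Set
  Basis B = T (isBasis M B)

  basis⇒ : ∀ {B} → Basis B → Indep B × ∣ B ∣ ≡ r
  basis⇒ {B} b = iB , ℕ.≤-antisym (indep-≤-r iB) r≤∣B∣
    where
    iB : Indep B
    iB = indepIn⇒indep (isBasis-indep b)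
    -- B is maximal, so it equals any extension of it to a set of size r
    r≤∣B∣ : r ≤ ∣ B ∣
    r≤∣B∣ with extend iB (indep⊆E iB)
    ... | Y , B⊆Y , _ , iY , ∣Y∣≡r =
      subst (_≤ ∣ B ∣) ∣Y∣≡r (p⊆q⇒∣p∣≤∣q∣ (isBasis-maximal b B⊆Y (indep⇒indepIn iY)))

  ⇒basis : ∀ {B} → Indep B → ∣ B ∣ ≡ r → Basis B
  ⇒basis {B} iB ∣B∣≡r = isBasis-intro (indep⇒indepIn iB) λ B⊆Y iY →
    ⊆-∣∣-reverse B⊆Y (subst (_ ≤_) (sym ∣B∣≡r) (indep-≤-r (indepIn⇒indep iY)))

  extend-to-basis : ∀ {X} → Indep X → ∃ λ B → X ⊆ B × Basis B
  extend-to-basis iX with extend iX (indep⊆E iX)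
  ... | B , X⊆B , _ , iB , ∣B∣≡r = B , X⊆B , ⇒basis iB ∣B∣≡r

  extend-within-basis : ∀ {X B} → Indep X → Basis B → ∃ λ Y → X ⊆ Y × Y ⊆ B ∪ X × Basis Y
  extend-within-basis {X} {B} iX bB with extend iX (q⊆p∪q B X)
  ... | Y , X⊆Y , Y⊆B∪X , iY , ∣Y∣≡rank =
    Y , X⊆Y , Y⊆B∪X , ⇒basis iY (ℕ.≤-antisym (indep-≤-r iY) r≤∣Y∣)
    where
    r≤∣Y∣ : r ≤ ∣ Y ∣
    r≤∣Y∣ = subst₂ _≤_ (proj₂ (basis⇒ bB)) (sym ∣Y∣≡rank)
              (indep-≤-rank (p⊆p∪q X) (proj₁ (basis⇒ bB)))

isMatroid-transfer : ∀ {n} (M₁ M₂ : SetSystem n) → ground M₁ ≡ ground M₂ →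
                     (∀ X → T (indep M₁ X) → T (indep M₂ X)) →
                     (∀ X → T (indep M₂ X) → T (indep M₁ X)) →
                     IsMatroid M₁ → IsMatroid M₂
isMatroid-transfer M₁ M₂ E₁≡E₂ to from m = record
  { indep-ground  = λ X → subst (λ G → T (X ⊆ᵇ G)) E₁≡E₂ ∘ indep-ground X ∘ from X
  ; indep-empty   = to Subset.⊥ indep-empty
  ; indep-hered   = λ X Y X⊆Y → to X ∘ indep-hered X Y X⊆Y ∘ from Y
  ; indep-augment = λ X Y iX iY ∣X∣<∣Y∣ →
      let (y , y∈Y , y∉X , iXy) = indep-augment X Y (from X iX) (from Y iY) ∣X∣<∣Y∣
      in y , y∈Y , y∉X , to (X ∪ ⁅ y ⁆) iXy
  }
  where open IsMatroid m

-- Its ground set is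
-- F = E − e, and with S = {e} when e is not a loop and S = ∅ when it is,
-- M/e has independent sets { X ⊆ F : X ∪ S independent in M }; it is a
-- matroid and r(M/e) + |S| = r(M).  Since M/e = (M* \ e)*, this is
-- proved through the bases of M* \ e, which are complements of bases of M.
module ElementContraction {n} (M : SetSystem n) (isMatroid : IsMatroid M) (e : Fin n)
    (S : Subset n) (S⊆e : S ⊆ ⁅ e ⁆) (iS : T (indep M S))
    (e∈S-or-loop : e ∈ S ⊎ (∀ {B} → T (indep M B) → e ∉ B)) where
  open MatroidFacts M isMatroid

  M/e : SetSystem n
  M/e = contract M ⁅ e ⁆

  F : Subset n
  F = ground M/e

  ∈F-intro : ∀ {x} → x ∈ E → x ≢ e → x ∈ F
  ∈F-intro x∈E x≢e = x∈p∩q⁺ (x∈E , x∈p∩q⁺ (x∈E , x∉p⇒x∈∁p (x≢e ∘ x∈⁅y⁆⇒x≡y e)))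

  F⊆E : F ⊆ E
  F⊆E = p∩q⊆p E _

  ∈F⇒≢e : ∀ {x} → x ∈ F → x ≢ e
  ∈F⇒≢e p refl = x∈∁p⇒x∉p (p∩q⊆q E _ (p∩q⊆q E _ p)) (x∈⁅x⁆ e)

  F-S-disjoint : Disjoint F S
  F-S-disjoint p q = ∈F⇒≢e p (x∈⁅y⁆⇒x≡y e (S⊆e q))

  e∈S : ∀ {B} → Indep B → e ∈ B → e ∈ S
  e∈S iB e∈B = [ (λ e∈S → e∈S) , (λ loop → ⊥-elim (loop iB e∈B)) ]′ e∈S-or-loop

  M*∖e : SetSystem n
  M*∖e = delete (dual M) ⁅ e ⁆

  open SetSystemFacts M*∖e using () renaming
    (isBasis-intro to co-isBasis-intro; isBasis-indep to co-isBasis-indep;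
     isBasis-maximal to co-isBasis-maximal)

  coindep-intro : ∀ {Z B} → Z ⊆ F → Basis B → Disjoint Z B → T (indepIn M*∖e Z)
  coindep-intro {Z} {B} Z⊆F bB Z∩B=∅ =
    ∧-intro (⊆⇒⊆ᵇ Z⊆F)
      (∧-intro (any-subsets-intro (λ B → isBasis M B ∧ (Z ⊆ᵇ (E ∩ ∁ B))) B
                  (∧-intro bB (⊆⇒⊆ᵇ (⊆-∩ (F⊆E ∘ Z⊆F) (x∉p⇒x∈∁p ∘ Z∩B=∅)))))
               (⊆⇒⊆ᵇ (p∩q⊆q E _ ∘ Z⊆F)))

  coindep-elim : ∀ {Z} → T (indepIn M*∖e Z) → Z ⊆ F × ∃ λ B → Basis B × Disjoint Z B
  coindep-elim {Z} t
    with any-subsets-elim (λ B → isBasis M B ∧ (Z ⊆ᵇ (E ∩ ∁ B))) (∧-fst (∧-snd {Z ⊆ᵇ F} t))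
  ... | B , u = ⊆ᵇ⇒⊆ (∧-fst t) , B , ∧-fst u ,
                λ p → x∈∁p⇒x∉p (p∩q⊆q E _ (⊆ᵇ⇒⊆ (∧-snd {isBasis M B} u) p))

  complement-basis : ∀ {B*} → Basis B* → (∀ {B} → Basis B → e ∈ B → e ∈ B*) →
                     T (isBasis M*∖e (F ∩ ∁ B*))
  complement-basis {B*} bB* e∈B⇒e∈B* =
    co-isBasis-intro (coindep-intro (p∩q⊆p F _) bB* (x∈∁p⇒x∉p ∘ p∩q⊆q F _)) maximal
    where
    maximal : ∀ {Y} → F ∩ ∁ B* ⊆ Y → T (indepIn M*∖e Y) → Y ⊆ F ∩ ∁ B*
    maximal {Y} F-B*⊆Y iY with coindep-elim iY
    ... | Y⊆F , B , bB , Y∩B=∅ = λ y∈Y → x∈p∩q⁺ (Y⊆F y∈Y , x∉p⇒x∈∁p (Y∩B=∅ y∈Y ∘ B*⊆B))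
      where
      B⊆B* : B ⊆ B*
      B⊆B* {x} x∈B with x ≟ e | x ∈? B*
      ... | yes refl | _ = e∈B⇒e∈B* bB x∈B
      ... | no _ | yes x∈B* = x∈B*
      ... | no x≢e | no x∉B* =
        ⊥-elim (Y∩B=∅ (F-B*⊆Y (x∈p∩q⁺ (∈F-intro (indep⊆E (proj₁ (basis⇒ bB)) x∈B) x≢e ,
                                          x∉p⇒x∈∁p x∉B*))) x∈B)
      B*⊆B : B* ⊆ B
      B*⊆B = ⊆-∣∣-reverse B⊆B*
               (ℕ.≤-reflexive (trans (proj₂ (basis⇒ bB*)) (sym (proj₂ (basis⇒ bB)))))

  complement-⊆-basis : ∀ {B' B*} → T (isBasis M*∖e B') → Basis B* → Disjoint B' B* →
                       F ∩ ∁ B* ⊆ B'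
  complement-⊆-basis {B'} {B*} bB' bB* B'∩B*=∅ =
    co-isBasis-maximal bB' B'⊆F-B* (coindep-intro (p∩q⊆p F _) bB* (x∈∁p⇒x∉p ∘ p∩q⊆q F _))
    where
    B'⊆F-B* : B' ⊆ F ∩ ∁ B*
    B'⊆F-B* = ⊆-∩ (proj₁ (coindep-elim (co-isBasis-indep bB'))) (x∉p⇒x∈∁p ∘ B'∩B*=∅)

  private
    coindepTest : Subset n → Subset n → Bool
    coindepTest X B' = isBasis M*∖e B' ∧ (X ⊆ᵇ (F ∩ ∁ B'))

  -- independent sets of M/e = (M* \ e)*, i.e. sets X ⊆ F avoiding a basis of M* \ e
  contract-indep⇒ : ∀ {X} → T (indep M/e X) → X ⊆ F × Indep (X ∪ S)
  contract-indep⇒ {X} t with any-subsets-elim (coindepTest X) t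
  ... | B' , u with coindep-elim (co-isBasis-indep (∧-fst {isBasis M*∖e B'} u))
  ... | B'⊆F , B , bB , B'∩B=∅ with extend-within-basis iS bB
  ... | Y , S⊆Y , Y⊆B∪S , bY = X⊆F , hereditary (proj₁ (basis⇒ bY)) (∪-⊆ X⊆Y S⊆Y)
    where
    X⊆F-B' : X ⊆ F ∩ ∁ B'
    X⊆F-B' = ⊆ᵇ⇒⊆ (∧-snd {isBasis M*∖e B'} u)
    X⊆F : X ⊆ F
    X⊆F = p∩q⊆p F _ ∘ X⊆F-B'
    B'∩Y=∅ : Disjoint B' Y
    B'∩Y=∅ p q = [ B'∩B=∅ p , F-S-disjoint (B'⊆F p) ]′ (x∈p∪q⁻ B S (Y⊆B∪S q))
    X⊆Y : X ⊆ Y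
    X⊆Y {x} p with x ∈? Y
    ... | yes x∈Y = x∈Y
    ... | no x∉Y = ⊥-elim (x∈∁p⇒x∉p (p∩q⊆q F _ (X⊆F-B' p))
                    (complement-⊆-basis (∧-fst {isBasis M*∖e B'} u) bY B'∩Y=∅
                       (x∈p∩q⁺ (X⊆F p , x∉p⇒x∈∁p x∉Y))))

  contract-indep⇐ : ∀ {X} → X ⊆ F → Indep (X ∪ S) → T (indep M/e X)
  contract-indep⇐ {X} X⊆F iXS with extend-to-basis iXS
  ... | B* , X∪S⊆B* , bB* =
    any-subsets-intro (coindepTest X) (F ∩ ∁ B*)
      (∧-intro (complement-basis bB* λ bB e∈B → X∪S⊆B* (q⊆p∪q X S (e∈S (proj₁ (basis⇒ bB)) e∈B)))
               (⊆⇒⊆ᵇ (⊆-∩ X⊆F (x∉p⇒x∈∁p ∘ X∩F-B*=∅))))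
    where
    X∩F-B*=∅ : Disjoint X (F ∩ ∁ B*)
    X∩F-B*=∅ p q = x∈∁p⇒x∉p (p∩q⊆q F _ q) (X∪S⊆B* (p⊆p∪q S p))

  ∣∪S∣ : ∀ X → X ⊆ F → ∣ X ∪ S ∣ ≡ ∣ X ∣ + ∣ S ∣
  ∣∪S∣ X X⊆F = ∣∪∣-disjoint X S (F-S-disjoint ∘ X⊆F)

  -- the explicit description of M/e, on which the axioms are checked
  M/e′ : SetSystem n
  M/e′ = setSystem F (λ X → (X ⊆ᵇ F) ∧ indep M (X ∪ S))

  M/e′-indep⇒ : ∀ {X} → T (indep M/e′ X) → X ⊆ F × Indep (X ∪ S)
  M/e′-indep⇒ {X} t = ⊆ᵇ⇒⊆ (∧-fst t) , ∧-snd {X ⊆ᵇ F} t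

  M/e′-indep⇐ : ∀ {X} → X ⊆ F → Indep (X ∪ S) → T (indep M/e′ X)
  M/e′-indep⇐ X⊆F iXS = ∧-intro (⊆⇒⊆ᵇ X⊆F) iXS

  M/e′-isMatroid : IsMatroid M/e′
  M/e′-isMatroid = record
    { indep-ground  = λ X → ∧-fst
    ; indep-empty   = M/e′-indep⇐ ⊥⊆ (hereditary iS (∪-⊆ ⊥⊆ ⊆-refl))
    ; indep-hered   = λ X Y X⊆ᵇY iY →
        let (Y⊆F , iYS) = M/e′-indep⇒ iY
            X⊆Y = ⊆ᵇ⇒⊆ X⊆ᵇY
        in M/e′-indep⇐ (Y⊆F ∘ X⊆Y) (hereditary iYS (∪-⊆ (p⊆p∪q S ∘ X⊆Y) (q⊆p∪q Y S)))
    ; indep-augment = augment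
    }
    where
    augment : ∀ X Y → T (indep M/e′ X) → T (indep M/e′ Y) → ∣ X ∣ < ∣ Y ∣ →
              ∃ λ y → (y ∈ Y) × (y ∉ X) × T (indep M/e′ (X ∪ ⁅ y ⁆))
    augment X Y iX iY ∣X∣<∣Y∣ with M/e′-indep⇒ iX | M/e′-indep⇒ iY
    ... | X⊆F , iXS | Y⊆F , iYS
      with IsMatroid.indep-augment isMatroid (X ∪ S) (Y ∪ S) iXS iYS
             (subst₂ _<_ (sym (∣∪S∣ X X⊆F)) (sym (∣∪S∣ Y Y⊆F)) (ℕ.+-monoˡ-< ∣ S ∣ ∣X∣<∣Y∣))
    ... | y , y∈Y∪S , y∉X∪S , iXSy = y , y∈Y , y∉X∪S ∘ p⊆p∪q S ,
          M/e′-indep⇐ (∪-⊆ X⊆F (⁅⁆-⊆ (Y⊆F y∈Y)))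
            (hereditary iXSy (∪-⊆ (∪-⊆ (p⊆p∪q ⁅ y ⁆ ∘ p⊆p∪q S) (q⊆p∪q (X ∪ S) ⁅ y ⁆))
                                  (p⊆p∪q ⁅ y ⁆ ∘ q⊆p∪q X S)))
      where
      y∈Y : y ∈ Y
      y∈Y = [ (λ q → q) , (λ q → ⊥-elim (y∉X∪S (q⊆p∪q X S q))) ]′ (x∈p∪q⁻ Y S y∈Y∪S)

  contraction-isMatroid : IsMatroid M/e
  contraction-isMatroid = isMatroid-transfer M/e′ M/e refl
    (λ X → uncurry (contract-indep⇐ {X}) ∘ M/e′-indep⇒)
    (λ X → uncurry M/e′-indep⇐ ∘ contract-indep⇒ {X})
    M/e′-isMatroid

  contraction-rank : rk M/e + ∣ S ∣ ≡ r
  contraction-rank = ℕ.≤-antisym upper lower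
    where
    open SetSystemFacts M/e using () renaming (rank-ub to rank/e-ub; rank-lub to rank/e-lub)
    upper : rk M/e + ∣ S ∣ ≤ r
    upper = ℕ.m≤o∸n⇒m+n≤o (rk M/e) (indep-≤-r iS) (rank/e-lub λ X X⊆F iX →
      ℕ.m+n≤o⇒m≤o∸n ∣ X ∣ (subst (_≤ r) (∣∪S∣ X X⊆F)
        (indep-≤-r (proj₂ (contract-indep⇒ {X} (∧-snd {X ⊆ᵇ F} iX))))))
    lower : r ≤ rk M/e + ∣ S ∣
    lower with extend-to-basis iS
    ... | B* , S⊆B* , bB* = begin
      r                   ≡⟨ proj₂ (basis⇒ bB*) ⟨
      ∣ B* ∣              ≤⟨ p⊆q⇒∣p∣≤∣q∣ B*⊆X∪S ⟩
      ∣ X ∪ S ∣           ≡⟨ ∣∪S∣ X X⊆F ⟩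
      ∣ X ∣ + ∣ S ∣       ≤⟨ ℕ.+-monoˡ-≤ ∣ S ∣ (rank/e-ub X⊆F (∧-intro (⊆⇒⊆ᵇ X⊆F) iX)) ⟩
      rk M/e + ∣ S ∣      ∎
      where
      open ℕ.≤-Reasoning
      X = F ∩ B*
      X⊆F : X ⊆ F
      X⊆F = p∩q⊆p F B*
      iX : T (indep M/e X)
      iX = contract-indep⇐ X⊆F (hereditary (proj₁ (basis⇒ bB*)) (∪-⊆ (p∩q⊆q F B*) S⊆B*))
      B*⊆X∪S : B* ⊆ X ∪ S
      B*⊆X∪S {x} x∈B* with x ≟ e
      ... | yes refl = q⊆p∪q X S (e∈S (proj₁ (basis⇒ bB*)) x∈B*)
      ... | no x≢e = p⊆p∪q S (x∈p∩q⁺ (∈F-intro (indep⊆E (proj₁ (basis⇒ bB*)) x∈B*) x≢e , x∈B*))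

  ∣E∣≡1+∣F∣ : e ∈ E → ∣ E ∣ ≡ suc ∣ F ∣
  ∣E∣≡1+∣F∣ e∈E = begin
    ∣ E ∣            ≡⟨ cong ∣_∣ (⊆-antisym E⊆F∪e (∪-⊆ F⊆E (⁅⁆-⊆ e∈E))) ⟩
    ∣ F ∪ ⁅ e ⁆ ∣    ≡⟨ ∣∪⁅⁆∣ (λ e∈F → ∈F⇒≢e e∈F refl) ⟩
    suc ∣ F ∣        ∎
    where
    open ≡-Reasoning
    E⊆F∪e : E ⊆ F ∪ ⁅ e ⁆
    E⊆F∪e {x} x∈E with x ≟ e
    ... | yes refl = q⊆p∪q F ⁅ e ⁆ (x∈⁅x⁆ e)
    ... | no x≢e = p⊆p∪q ⁅ e ⁆ (∈F-intro x∈E x≢e)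

countᵇ : ∀ {A : Set} → (A → Bool) → List A → ℕ
countᵇ p [] = 0
countᵇ p (x ∷ xs) = if p x then suc (countᵇ p xs) else countᵇ p xs

countᵇ-++ : ∀ {A : Set} (p : A → Bool) xs ys → countᵇ p (xs ++ ys) ≡ countᵇ p xs + countᵇ p ys
countᵇ-++ p [] ys = refl
countᵇ-++ p (x ∷ xs) ys with p x
... | true = cong suc (countᵇ-++ p xs ys)
... | false = countᵇ-++ p xs ys

countᵇ-map : ∀ {A B : Set} (p : B → Bool) (f : A → B) xs → countᵇ p (map f xs) ≡ countᵇ (p ∘ f) xs
countᵇ-map p f [] = refl
countᵇ-map p f (x ∷ xs) with p (f x)
... | true = cong suc (countᵇ-map p f xs)
... | false = countᵇ-map p f xs

countᵇ-none : ∀ {A : Set} (p : A → Bool) xs → (∀ x → p x ≡ false) → countᵇ p xs ≡ 0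
countᵇ-none p [] h = refl
countᵇ-none p (x ∷ xs) h rewrite h x = countᵇ-none p xs h

countᵇ-allSubsets : ∀ {n} (p : Subset (suc n) → Bool) → countᵇ p (allSubsets (suc n)) ≡
                    countᵇ (p ∘ (false ∷_)) (allSubsets n) + countᵇ (p ∘ (true ∷_)) (allSubsets n)
countᵇ-allSubsets {n} p = begin
  countᵇ p (map (false ∷_) (allSubsets n) ++ map (true ∷_) (allSubsets n))
    ≡⟨ countᵇ-++ p (map (false ∷_) (allSubsets n)) (map (true ∷_) (allSubsets n)) ⟩
  countᵇ p (map (false ∷_) (allSubsets n)) + countᵇ p (map (true ∷_) (allSubsets n))
    ≡⟨ cong₂ _+_ (countᵇ-map p (false ∷_) (allSubsets n)) (countᵇ-map p (true ∷_) (allSubsets n)) ⟩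
  countᵇ (p ∘ (false ∷_)) (allSubsets n) + countᵇ (p ∘ (true ∷_)) (allSubsets n) ∎
  where open ≡-Reasoning

#empty-subsets : ∀ {n} (E : Subset n) → countᵇ (λ A → (A ⊆ᵇ E) ∧ (∣ A ∣ ≡ᵇ 0)) (allSubsets n) ≡ 1
#empty-subsets [] = refl
#empty-subsets {suc n} (x ∷ E) =
  trans (countᵇ-allSubsets (λ A → (A ⊆ᵇ (x ∷ E)) ∧ (∣ A ∣ ≡ᵇ 0)))
        (cong₂ _+_ (#empty-subsets E) (countᵇ-none _ (allSubsets n) (λ A → ∧-zeroʳ _)))

#singletons : ∀ {n} (E : Subset n) → countᵇ (λ A → (A ⊆ᵇ E) ∧ (∣ A ∣ ≡ᵇ 1)) (allSubsets n) ≡ ∣ E ∣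
#singletons [] = refl
#singletons {suc n} (false ∷ E) =
  trans (countᵇ-allSubsets (λ A → (A ⊆ᵇ (false ∷ E)) ∧ (∣ A ∣ ≡ᵇ 1)))
        (trans (cong₂ _+_ (#singletons E) (countᵇ-none _ (allSubsets n) (λ A → refl)))
               (ℕ.+-identityʳ _))
#singletons {suc n} (true ∷ E) =
  trans (countᵇ-allSubsets (λ A → (A ⊆ᵇ (true ∷ E)) ∧ (∣ A ∣ ≡ᵇ 1)))
        (trans (cong₂ _+_ (#singletons E) (#empty-subsets E)) (ℕ.+-comm _ 1))

ℕ→ℚ : ℕ → ℚ
ℕ→ℚ zero = ℚ.0ℚ
ℕ→ℚ (suc m) = ℚ.1ℚ ℚ.+ ℕ→ℚ m

ℕ→ℚ-unnormalised : ∀ m → ℚ.toℚᵘ (ℕ→ℚ m) ℚᵘ.≃ mkℚᵘ (ℤ.+ m) 0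
ℕ→ℚ-unnormalised zero = *≡* refl
ℕ→ℚ-unnormalised (suc m) =
  ℚᵘ.≃-trans (ℚ.toℚᵘ-homo-+ ℚ.1ℚ (ℕ→ℚ m))
    (ℚᵘ.≃-trans (ℚᵘ.+-cong {ℚ.toℚᵘ ℚ.1ℚ} {ℚᵘ.1ℚᵘ} (*≡* refl) (ℕ→ℚ-unnormalised m)) (one-plus m))
  where
  -- 1 + m/1 = (1 + m)/1, a numerator identity up to the factors 1
  one-plus : ∀ m → ℚᵘ.1ℚᵘ ℚᵘ.+ mkℚᵘ (ℤ.+ m) 0 ℚᵘ.≃ mkℚᵘ (ℤ.+ suc m) 0
  one-plus zero = *≡* refl
  one-plus (suc m) = *≡* (cong (λ x → ℤ.+ suc (suc x)) (ℕ.*-identityʳ (m Data.Nat.* 1)))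

-- (1/m) · m = 1, checked on unnormalised representatives where 1/(m/1) = 1/m
inverse-ℕ→ℚ : ∀ m .{{_ : NonZero m}} → ((ℤ.+ 1) ℚ./ m) ℚ.* ℕ→ℚ m ≡ ℚ.1ℚ
inverse-ℕ→ℚ (suc j) = ℚ.toℚᵘ-injective
  (ℚᵘ.≃-trans (ℚ.toℚᵘ-homo-* ((ℤ.+ 1) ℚ./ suc j) (ℕ→ℚ (suc j)))
    (ℚᵘ.≃-trans (ℚᵘ.*-cong (ℚ.toℚᵘ-fromℚᵘ (mkℚᵘ (ℤ.+ 1) j)) (ℕ→ℚ-unnormalised (suc j)))
                (ℚᵘ.*-inverseˡ (mkℚᵘ (ℤ.+ suc j) 0))))

module ConvolutionPowers {c ℓ} (K : QAlgebra c ℓ) (a b : QAlgebra.Carrier K) where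
  open QAlgebra K renaming (_+_ to _⊕_; refl to ≈-refl; sym to ≈-sym; trans to ≈-trans)
  open import Algebra.Properties.Semiring.Mult semiring
    using (×-homo-1; ×-assocˡ; ×-assoc-*; ×-comm-*; ×-congʳ)
    renaming (_×_ to _·_)
  open import Relation.Binary.Reasoning.Setoid setoid
  open import Data.Nat using (_!)

  δ : MapK K
  δ = linComb K a b

  monomial : ∀ {n} → SetSystem n → Carrier
  monomial M = pow K a (rk M) * pow K b (nullity M)

  predicted : ℕ → ∀ {n} → SetSystem n → Carrier
  predicted k M = if k ≡ᵇ ∣ ground M ∣ then (k !) · monomial M else 0#

  sum-cong : ∀ {A : Set} {f g : A → Carrier} → (∀ x → f x ≈ g x) → ∀ xs →
             sumK K (map f xs) ≈ sumK K (map g xs)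
  sum-cong f≈g [] = ≈-refl
  sum-cong f≈g (x ∷ xs) = +-cong (f≈g x) (sum-cong f≈g xs)

  sum-filterᵇ : ∀ {A : Set} (f : A → Carrier) p xs →
                sumK K (map f (filterᵇ p xs)) ≈ sumK K (map (λ x → if p x then f x else 0#) xs)
  sum-filterᵇ f p [] = ≈-refl
  sum-filterᵇ f p (x ∷ xs) with p x
  ... | true = +-cong ≈-refl (sum-filterᵇ f p xs)
  ... | false = ≈-trans (sum-filterᵇ f p xs) (≈-sym (+-identityˡ _))

  sum-indicator : ∀ {A : Set} (p : A → Bool) v xs →
                  sumK K (map (λ x → if p x then v else 0#) xs) ≈ countᵇ p xs · v
  sum-indicator p v [] = ≈-refl
  sum-indicator p v (x ∷ xs) with p x
  ... | true = +-cong ≈-refl (sum-indicator p v xs)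
  ... | false = ≈-trans (+-identityˡ _) (sum-indicator p v xs)

  ·-if : ∀ m c y → m · (if c then y else 0#) ≈ (if c then m · y else 0#)
  ·-if m true y = ≈-refl
  ·-if zero false y = ≈-refl
  ·-if (suc m) false y = ≈-trans (+-identityˡ _) (·-if m false y)

  *-if : ∀ x c y → x * (if c then y else 0#) ≈ (if c then x * y else 0#)
  *-if x true y = ≈-refl
  *-if x false y = zeroʳ x

  if-cong : ∀ c {x y} → (T c → x ≈ y) → (if c then x else 0#) ≈ (if c then y else 0#)
  if-cong true x≈y = x≈y tt
  if-cong false x≈y = ≈-refl

  -- δ(M) only depends on three bits: |E| = 1, ∅ independent, E independent
  weight : Bool → Bool → Bool → Carrier
  weight one i∅ iE = a * (if one ∧ i∅ ∧ iE     then 1# else 0#)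
                   ⊕ b * (if one ∧ i∅ ∧ not iE then 1# else 0#)

  δ≡weight : ∀ {n} (M : SetSystem n) →
             δ M ≡ weight (∣ ground M ∣ ≡ᵇ 1) (indepIn M Subset.⊥) (indepIn M (ground M))
  δ≡weight M = refl

  weight-zero : ∀ i∅ iE → weight false i∅ iE ≈ 0#
  weight-zero i∅ iE = ≈-trans (+-cong (zeroʳ a) (zeroʳ b)) (+-identityʳ 0#)

  weight-one : ∀ iE → weight true true iE ≈ (if iE then a else b)
  weight-one true = ≈-trans (+-cong (*-identityʳ a) (zeroʳ b)) (+-identityʳ a)
  weight-one false = ≈-trans (+-cong (zeroʳ a) (*-identityʳ b)) (+-identityˡ b)

  δ-restrict-nonsingleton : ∀ {n} (M : SetSystem n) A → A ⊆ ground M → (∣ A ∣ ≡ᵇ 1) ≡ false →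
                            δ (restrict M A) ≈ 0#
  δ-restrict-nonsingleton M A A⊆E ∣A∣≢1 = begin
    δ (restrict M A)
      ≡⟨ δ≡weight (restrict M A) ⟩
    weight (∣ ground M ∩ A ∣ ≡ᵇ 1) i∅ iE
      ≡⟨ cong (λ one → weight one i∅ iE) (trans (cong (λ X → ∣ X ∣ ≡ᵇ 1) E∩A≡A) ∣A∣≢1) ⟩
    weight false i∅ iE
      ≈⟨ weight-zero i∅ iE ⟩
    0# ∎
    where
    i∅ = indepIn (restrict M A) Subset.⊥
    iE = indepIn (restrict M A) (ground M ∩ A)
    E∩A≡A : ground M ∩ A ≡ A
    E∩A≡A = ⊆-antisym (p∩q⊆q (ground M) A) (⊆-∩ A⊆E (λ p → p))

  δ-restrict-singleton : ∀ {n} (M : SetSystem n) e → e ∈ ground M → T (indep M Subset.⊥) →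
                         ∀ {t} → indep M ⁅ e ⁆ ≡ t → δ (restrict M ⁅ e ⁆) ≈ (if t then a else b)
  δ-restrict-singleton M e e∈E i∅ refl = begin
    δ (restrict M ⁅ e ⁆)
      ≡⟨ δ≡weight M|e ⟩
    weight (∣ G ∣ ≡ᵇ 1) (indepIn M|e Subset.⊥) (indepIn M|e G)
      ≡⟨ cong (λ one → weight one (indepIn M|e Subset.⊥) (indepIn M|e G)) one-element ⟩
    weight true (indepIn M|e Subset.⊥) (indepIn M|e G)
      ≡⟨ cong₂ (weight true) ∅-independent E-independent ⟩
    weight true true (indep M ⁅ e ⁆)
      ≈⟨ weight-one (indep M ⁅ e ⁆) ⟩
    (if indep M ⁅ e ⁆ then a else b) ∎
    where
    M|e = restrict M ⁅ e ⁆
    G = ground M ∩ ⁅ e ⁆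
    G≡e : G ≡ ⁅ e ⁆
    G≡e = ⊆-antisym (p∩q⊆q (ground M) ⁅ e ⁆) (⊆-∩ (⁅⁆-⊆ e∈E) (λ p → p))
    one-element : (∣ G ∣ ≡ᵇ 1) ≡ true
    one-element = trans (cong (λ X → ∣ X ∣ ≡ᵇ 1) G≡e) (cong (_≡ᵇ 1) (∣⁅x⁆∣≡1 e))
    ∅-independent : indepIn M|e Subset.⊥ ≡ true
    ∅-independent = T⇒≡true (∧-intro (⊆⇒⊆ᵇ {X = Subset.⊥} {G} ⊥⊆)
                                       (∧-intro i∅ (⊆⇒⊆ᵇ {X = Subset.⊥} {⁅ e ⁆} ⊥⊆)))
    e⊆ᵇe : (⁅ e ⁆ ⊆ᵇ ⁅ e ⁆) ≡ true
    e⊆ᵇe = T⇒≡true (⊆⇒⊆ᵇ {X = ⁅ e ⁆} ⊆-refl)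
    E-independent : indepIn M|e G ≡ indep M ⁅ e ⁆
    E-independent =
      trans (cong (λ X → (X ⊆ᵇ X) ∧ (indep M X ∧ (X ⊆ᵇ ⁅ e ⁆))) G≡e)
            (trans (cong₂ (λ u v → u ∧ (indep M ⁅ e ⁆ ∧ v)) e⊆ᵇe e⊆ᵇe)
                   (∧-identityʳ (indep M ⁅ e ⁆)))

  monomial≡ : ∀ {n} (M : SetSystem n) {r ν} → rk M ≡ r → nullity M ≡ ν →
              monomial M ≡ pow K a r * pow K b ν
  monomial≡ M refl refl = refl

  -- contracting a non-loop lowers the rank, contracting a loop lowers the nullity
  monomial-nonloop : ∀ {n} (M N : SetSystem n) → rk M ≡ suc (rk N) → nullity M ≡ nullity N →
                    a * monomial N ≈ monomial M
  monomial-nonloop M N rM nM = begin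
    a * (pow K a (rk N) * pow K b (nullity N)) ≈⟨ *-assoc a _ _ ⟨
    pow K a (suc (rk N)) * pow K b (nullity N) ≡⟨ monomial≡ M rM nM ⟨
    monomial M ∎

  monomial-loop : ∀ {n} (M N : SetSystem n) → rk M ≡ rk N → nullity M ≡ suc (nullity N) →
                  b * monomial N ≈ monomial M
  monomial-loop M N rM nM = begin
    b * (pow K a (rk N) * pow K b (nullity N)) ≈⟨ *-assoc b _ _ ⟨
    (b * pow K a (rk N)) * pow K b (nullity N) ≈⟨ *-cong (*-comm b _) ≈-refl ⟩
    (pow K a (rk N) * b) * pow K b (nullity N) ≈⟨ *-assoc _ b _ ⟩
    pow K a (rk N) * pow K b (suc (nullity N)) ≡⟨ monomial≡ M rM nM ⟨
    monomial M ∎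

  -- each of the |E| one-element subsets of M contributes this to δ^{∗(k+1)}(M)
  perElement : ℕ → ∀ {n} → SetSystem n → Carrier
  perElement k M = if suc k ≡ᵇ ∣ ground M ∣ then (k !) · monomial M else 0#

  predicted-step : ∀ {n} (M N : SetSystem n) w k → ∣ ground M ∣ ≡ suc ∣ ground N ∣ →
                   w * monomial N ≈ monomial M → w * predicted k N ≈ perElement k M
  predicted-step M N w k ∣E∣≡ w·mN≈mM = begin
    w * (if k ≡ᵇ ∣ ground N ∣ then (k !) · monomial N else 0#)
      ≈⟨ *-if w (k ≡ᵇ ∣ ground N ∣) _ ⟩
    (if k ≡ᵇ ∣ ground N ∣ then w * ((k !) · monomial N) else 0#)
      ≈⟨ if-cong (k ≡ᵇ ∣ ground N ∣) (λ _ → ≈-trans (×-comm-* (k !) w _) (×-congʳ (k !) w·mN≈mM)) ⟩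
    (if suc k ≡ᵇ suc ∣ ground N ∣ then (k !) · monomial M else 0#)
      ≡⟨ cong (λ m → if suc k ≡ᵇ m then (k !) · monomial M else 0#) (sym ∣E∣≡) ⟩
    perElement k M ∎

  sum-perElement : ∀ k {n} (M : SetSystem n) → ∣ ground M ∣ · perElement k M ≈ predicted (suc k) M
  sum-perElement k M with suc k ≡ᵇ ∣ ground M ∣ in eq
  ... | false = ·-if ∣ ground M ∣ false ((k !) · monomial M)
  ... | true = let ∣E∣≡1+k = sym (ℕ.≡ᵇ⇒≡ (suc k) ∣ ground M ∣ (subst T (sym eq) tt)) in begin
    ∣ ground M ∣ · ((k !) · monomial M)    ≈⟨ ×-assocˡ (monomial M) ∣ ground M ∣ (k !) ⟩
    (∣ ground M ∣ Data.Nat.* k !) · monomial M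
      ≡⟨ cong (λ m → (m Data.Nat.* k !) · monomial M) ∣E∣≡1+k ⟩
    (suc k !) · monomial M ∎

  contraction-term : ∀ k {n} (M : SetSystem n) e w → δ (restrict M ⁅ e ⁆) ≈ w →
                     convPow K δ k (contract M ⁅ e ⁆) ≈ predicted k (contract M ⁅ e ⁆) →
                     ∣ ground M ∣ ≡ suc ∣ ground (contract M ⁅ e ⁆) ∣ →
                     w * monomial (contract M ⁅ e ⁆) ≈ monomial M →
                     δ (restrict M ⁅ e ⁆) * convPow K δ k (contract M ⁅ e ⁆) ≈ perElement k M
  contraction-term k M e w δ≈w formula ∣E∣≡ w·m≈m =
    ≈-trans (*-cong δ≈w formula) (predicted-step M (contract M ⁅ e ⁆) w k ∣E∣≡ w·m≈m)

  -- Given the formula for δ^{∗k}, every singleton {e} ⊆ E contributes perElement k M: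
  -- a non-loop e has weight a and drops the rank, a loop has weight b and drops the nullity.
  singleton-term : ∀ k → (∀ {n} (N : SetSystem n) → IsMatroid N → convPow K δ k N ≈ predicted k N) →
                   ∀ {n} (M : SetSystem n) → IsMatroid M → ∀ e → e ∈ ground M →
                   δ (restrict M ⁅ e ⁆) * convPow K δ k (contract M ⁅ e ⁆) ≈ perElement k M
  singleton-term k formula {n} M isMatroid e e∈E with indep M ⁅ e ⁆ in e-indep
  ... | true =
    contraction-term k M e a (δ-restrict-singleton M e e∈E i∅ e-indep)
      (formula M/e contraction-isMatroid) (∣E∣≡1+∣F∣ e∈E)
      (monomial-nonloop M M/e rk-drops (cong₂ _∸_ (∣E∣≡1+∣F∣ e∈E) rk-drops))
    where
    open ElementContraction M isMatroid e ⁅ e ⁆ ⊆-refl (subst T (sym e-indep) tt) (inj₁ (x∈⁅x⁆ e))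
    open IsMatroid isMatroid renaming (indep-empty to i∅)
    rk-drops : rk M ≡ suc (rk M/e)
    rk-drops = trans (sym contraction-rank) (trans (cong (rk M/e +_) (∣⁅x⁆∣≡1 e)) (ℕ.+-comm _ 1))
  ... | false =
    contraction-term k M e b (δ-restrict-singleton M e e∈E i∅ e-indep)
      (formula M/e contraction-isMatroid) (∣E∣≡1+∣F∣ e∈E)
      (monomial-loop M M/e rk-stays nullity-drops)
    where
    open MatroidFacts M isMatroid using (hereditary)
    open IsMatroid isMatroid renaming (indep-empty to i∅)
    e-loop : ∀ {B} → T (indep M B) → e ∉ B
    e-loop iB e∈B = subst T e-indep (hereditary iB (⁅⁆-⊆ e∈B))
    open ElementContraction M isMatroid e Subset.⊥ ⊥⊆ i∅ (inj₂ e-loop)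
    rk-stays : rk M ≡ rk M/e
    rk-stays = trans (sym contraction-rank) (trans (cong (rk M/e +_) (∣⊥∣≡0 n)) (ℕ.+-identityʳ _))
    nullity-drops : nullity M ≡ suc (nullity M/e)
    nullity-drops = trans (cong₂ _∸_ (∣E∣≡1+∣F∣ e∈E) rk-stays)
                          (ℕ.+-∸-assoc 1 (SetSystemFacts.rk≤∣ground∣ M/e))

  -- δ^{∗0} = ε: a matroid with empty ground set has rank and nullity 0
  convPow-zero : ∀ {n} (M : SetSystem n) → convPow K δ 0 M ≈ predicted 0 M
  convPow-zero M = begin
    (if ∣ ground M ∣ ≡ᵇ 0 then 1# else 0#)
      ≈⟨ if-cong (∣ ground M ∣ ≡ᵇ 0) (λ t → monomial-empty (ℕ.≡ᵇ⇒≡ ∣ ground M ∣ 0 t)) ⟩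
    (if ∣ ground M ∣ ≡ᵇ 0 then 1 · monomial M else 0#)
      ≡⟨ cong (λ c → if c then 1 · monomial M else 0#) (≡ᵇ0-sym ∣ ground M ∣) ⟩
    predicted 0 M ∎
    where
    ≡ᵇ0-sym : ∀ m → (m ≡ᵇ 0) ≡ (0 ≡ᵇ m)
    ≡ᵇ0-sym zero = refl
    ≡ᵇ0-sym (suc m) = refl
    monomial-empty : ∣ ground M ∣ ≡ 0 → 1# ≈ 1 · monomial M
    monomial-empty ∣E∣≡0 = begin
      1#                     ≈⟨ *-identityʳ 1# ⟨
      pow K a 0 * pow K b 0  ≡⟨ monomial≡ M rk≡0 (cong₂ _∸_ ∣E∣≡0 rk≡0) ⟨
      monomial M             ≈⟨ ×-homo-1 (monomial M) ⟨
      1 · monomial M ∎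
      where
      rk≡0 : rk M ≡ 0
      rk≡0 = ℕ.n≤0⇒n≡0 (subst (rk M ≤_) ∣E∣≡0 (SetSystemFacts.rk≤∣ground∣ M))

  -- Main formula: δ^{∗k}(M) = k! a^{r(M)} b^{n(M)} if k = |E| and 0 otherwise.
  -- In δ^{∗(k+1)}(M) = Σ_{A ⊆ E} δ(M|A) δ^{∗k}(M/A) only the |E| singletons A
  -- contribute, each perElement k M.
  convPow-formula : ∀ k {n} (M : SetSystem n) → IsMatroid M → convPow K δ k M ≈ predicted k M
  convPow-formula zero M _ = convPow-zero M
  convPow-formula (suc k) {n} M isMatroid = begin
    sumK K (map term (filterᵇ (_⊆ᵇ E) (allSubsets n)))
      ≈⟨ sum-filterᵇ term (_⊆ᵇ E) (allSubsets n) ⟩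
    sumK K (map (λ A → if A ⊆ᵇ E then term A else 0#) (allSubsets n))
      ≈⟨ sum-cong only-singletons (allSubsets n) ⟩
    sumK K (map (λ A → if singleton? A then perElement k M else 0#) (allSubsets n))
      ≈⟨ sum-indicator singleton? (perElement k M) (allSubsets n) ⟩
    countᵇ singleton? (allSubsets n) · perElement k M
      ≡⟨ cong (_· perElement k M) (#singletons E) ⟩
    ∣ E ∣ · perElement k M
      ≈⟨ sum-perElement k M ⟩
    predicted (suc k) M ∎
    where
    E = ground M
    term : Subset n → Carrier
    term A = δ (restrict M A) * convPow K δ k (contract M A)
    singleton? : Subset n → Bool
    singleton? A = (A ⊆ᵇ E) ∧ (∣ A ∣ ≡ᵇ 1)
    only-singletons : ∀ A → (if A ⊆ᵇ E then term A else 0#) ≈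
                            (if singleton? A then perElement k M else 0#)
    only-singletons A with A ⊆ᵇ E in A⊆ᵇE | ∣ A ∣ ≡ᵇ 1 in ∣A∣≡ᵇ1
    ... | false | _ = ≈-refl
    ... | true | false =
      ≈-trans (*-cong (δ-restrict-nonsingleton M A (⊆ᵇ⇒⊆ (subst T (sym A⊆ᵇE) tt)) ∣A∣≡ᵇ1) ≈-refl)
              (zeroˡ _)
    ... | true | true with ∣∣≡1⇒singleton A (ℕ.≡ᵇ⇒≡ ∣ A ∣ 1 (subst T (sym ∣A∣≡ᵇ1) tt))
    ...   | e , refl = singleton-term k (λ N → convPow-formula k N) M isMatroid e
                         (⊆ᵇ⇒⊆ (subst T (sym A⊆ᵇE) tt) (x∈⁅x⁆ e))

  open IsRingHomomorphism ι-hom using (0#-homo; 1#-homo; +-homo; *-homo)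

  ι-ℕ→ℚ : ∀ m → ι (ℕ→ℚ m) ≈ m · 1#
  ι-ℕ→ℚ zero = 0#-homo
  ι-ℕ→ℚ (suc m) = ≈-trans (+-homo ℚ.1ℚ (ℕ→ℚ m)) (+-cong 1#-homo (ι-ℕ→ℚ m))

  1/_! : ℕ → ℚ
  1/ k ! = ((ℤ.+ 1) ℚ./ (k !)) {{k ℕ.!≢0}}

  cancel-factorial : ∀ k y → ι (1/ k !) * ((k !) · y) ≈ y
  cancel-factorial k y = begin
    ι (1/ k !) * ((k !) · y)
      ≈⟨ *-cong ≈-refl (≈-trans (×-assoc-* (k !) 1# y) (×-congʳ (k !) (*-identityˡ y))) ⟨
    ι (1/ k !) * ((k !) · 1# * y)     ≈⟨ *-assoc _ _ y ⟨
    (ι (1/ k !) * (k !) · 1#) * y     ≈⟨ *-cong (*-cong ≈-refl (ι-ℕ→ℚ (k !))) ≈-refl ⟨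
    (ι (1/ k !) * ι (ℕ→ℚ (k !))) * y  ≈⟨ *-cong (*-homo _ _) ≈-refl ⟨
    ι (1/ k ! ℚ.* ℕ→ℚ (k !)) * y     ≡⟨ cong (λ q → ι q * y) (inverse-ℕ→ℚ (k !) {{k ℕ.!≢0}}) ⟩
    ι ℚ.1ℚ * y                      ≈⟨ *-cong 1#-homo ≈-refl ⟩
    1# * y                          ≈⟨ *-identityˡ y ⟩
    y ∎

  sum-single-term : ∀ {j m} (f : ℕ → Carrier) → j < m → (∀ k → k ≢ j → f k ≈ 0#) →
                    sumK K (applyUpTo f m) ≈ f j
  sum-single-term {zero} {suc m} f _ others =
    ≈-trans (+-cong ≈-refl (zeros m (λ k → others (suc k) λ ()))) (+-identityʳ _)
    where
    zeros : ∀ m {g : ℕ → Carrier} → (∀ k → g k ≈ 0#) → sumK K (applyUpTo g m) ≈ 0#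
    zeros zero g≈0 = ≈-refl
    zeros (suc m) g≈0 = ≈-trans (+-cong (g≈0 0) (zeros m (g≈0 ∘ suc))) (+-identityʳ 0#)
  sum-single-term {suc j} {suc m} f (s≤s j<m) others =
    ≈-trans (+-cong (others 0 λ ())
                    (sum-single-term (f ∘ suc) j<m λ k k≢j → others (suc k) (k≢j ∘ ℕ.suc-injective)))
            (+-identityˡ _)

  exp-term : ℕ → ∀ {n} → SetSystem n → Carrier
  exp-term k M = ι (1/ k !) * convPow K δ k M

  exp-term-diagonal : ∀ {n} (M : SetSystem n) → IsMatroid M →
                      exp-term ∣ ground M ∣ M ≈ monomial M
  exp-term-diagonal M isMatroid = begin
    ι (1/ size !) * convPow K δ size M
      ≈⟨ *-cong ≈-refl (convPow-formula size M isMatroid) ⟩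
    ι (1/ size !) * predicted size M
      ≡⟨ cong (λ c → ι (1/ size !) * (if c then (size !) · monomial M else 0#))
              (T⇒≡true (ℕ.≡⇒≡ᵇ size size refl)) ⟩
    ι (1/ size !) * ((size !) · monomial M)
      ≈⟨ cancel-factorial size (monomial M) ⟩
    monomial M ∎
    where
    size : ℕ
    size = ∣ ground M ∣

  exp-term-off-diagonal : ∀ {n} (M : SetSystem n) → IsMatroid M →
                          ∀ k → k ≢ ∣ ground M ∣ → exp-term k M ≈ 0#
  exp-term-off-diagonal M isMatroid k k≢∣E∣ = begin
    ι (1/ k !) * convPow K δ k M
      ≈⟨ *-cong ≈-refl (convPow-formula k M isMatroid) ⟩
    ι (1/ k !) * predicted k M
      ≡⟨ cong (λ c → ι (1/ k !) * (if c then (k !) · monomial M else 0#))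
              (¬T⇒≡false (k≢∣E∣ ∘ ℕ.≡ᵇ⇒≡ k ∣ ground M ∣)) ⟩
    ι (1/ k !) * 0#
      ≈⟨ zeroʳ _ ⟩
    0# ∎

mainTheorem1 : ∀ {c ℓ : Level} (K : QAlgebra c ℓ) (a b : QAlgebra.Carrier K)
               {n : ℕ} (M : SetSystem n) → IsMatroid M →
               ∀ (N : ℕ) → ∣ ground M ∣ ≤ N →
               QAlgebra._≈_ K (expPartial K (linComb K a b) N M)
                              (QAlgebra._*_ K (pow K a (rk M)) (pow K b (nullity M)))
mainTheorem1 K a b M isMatroid N ∣E∣≤N = begin
  sumK K (map (λ k → exp-term k M) (upTo (suc N)))
    ≡⟨ cong (sumK K) (map-upTo (λ k → exp-term k M) (suc N)) ⟩
  sumK K (applyUpTo (λ k → exp-term k M) (suc N))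
    ≈⟨ sum-single-term (λ k → exp-term k M) (s≤s ∣E∣≤N) (exp-term-off-diagonal M isMatroid) ⟩
  exp-term ∣ ground M ∣ M
    ≈⟨ exp-term-diagonal M isMatroid ⟩
  monomial M ∎
  where
  open ConvolutionPowers K a b
  open QAlgebra K using (setoid)
  open import Relation.Binary.Reasoning.Setoid setoid
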